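{- For any integers $1\leq n<m$, there exists a connected graph $G$ with $D(G)=n$ and $\dim(G)=m$.
   Context: All graphs are finite and simple. For a connected graph $G$ with shortest-path distance $d_G$, a set $S\subseteq V(G)$ is a resolving set if for any two distinct vertices $g_1,g_2$ of $G$ there is $s\in S$ with $d_G(g_1,s)\neq d_G(g_2,s)$; the metric dimension $\dim(G)$ is the minimum size of a resolving set. A distinguishing coloring of $G$ is a vertex coloring such that no non-trivial automorphism of $G$ preserves the coloring; the distinguishing number $D(G)$ is the minimum number of colors in a distinguishing coloring. -}

module Defs where

open import Data.Nat using (ℕ; zero; suc; _≤_)
open import Data.Bool using (Bool; true; false)
open import Data.Fin using (Fin)
open import Data.Fin.Subset using (Subset; _∈_; ∣_∣)
open import Data.Fin.Permutation using (Permutation′; _⟨$⟩ʳ_)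
open import Data.Product using (Σ; ∃; _×_; _,_)
open import Relation.Binary.PropositionalEquality using (_≡_; _≢_)

record Graph : Set where
  field
    order : ℕ
    adj   : Fin order → Fin order → Bool
    adj-sym   : ∀ u v → adj u v ≡ adj v u
    adj-irrefl : ∀ u → adj u u ≡ false
open Graph public

data Walk (G : Graph) : Fin (order G) → Fin (order G) → ℕ → Set where
  here : ∀ {u} → Walk G u u zero
  step : ∀ {u w v l} → adj G u w ≡ true → Walk G w v l → Walk G u v (suc l)

Connected : Graph → Set
Connected G = ∀ u v → ∃ λ l → Walk G u v l

IsDist : (G : Graph) → Fin (order G) → Fin (order G) → ℕ → Set
IsDist G u v d = Walk G u v d × (∀ l → Walk G u v l → d ≤ l)

Resolving : (G : Graph) → Subset (order G) → Set
Resolving G S = ∀ x y → x ≢ y →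
  Σ (Fin (order G)) λ s → s ∈ S × ∃ λ d₁ → ∃ λ d₂ →
    IsDist G x s d₁ × IsDist G y s d₂ × d₁ ≢ d₂

MetricDim : Graph → ℕ → Set
MetricDim G m =
  (Σ (Subset (order G)) λ S → Resolving G S × ∣ S ∣ ≡ m) ×
  (∀ (S : Subset (order G)) → Resolving G S → m ≤ ∣ S ∣)

IsAutomorphism : (G : Graph) → Permutation′ (order G) → Set
IsAutomorphism G π = ∀ u v → adj G (π ⟨$⟩ʳ u) (π ⟨$⟩ʳ v) ≡ adj G u v

Distinguishing : (G : Graph) {r : ℕ} → (Fin (order G) → Fin r) → Set
Distinguishing G c = ∀ (π : Permutation′ (order G)) → IsAutomorphism G π →
  (∀ v → c (π ⟨$⟩ʳ v) ≡ c v) → ∀ v → π ⟨$⟩ʳ v ≡ v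

DistNumber : Graph → ℕ → Set
DistNumber G n =
  (Σ (Fin (order G) → Fin n) λ c → Distinguishing G c) ×
  (∀ (r : ℕ) (c : Fin (order G) → Fin r) → Distinguishing G c → n ≤ r)

-- The graph is a spider: m + 1 paths (legs) hanging from a hub, legs 0, …, n − 1 being single
-- pendant vertices and leg i ≥ n having i − n + 2 vertices. The tops of two legs are equidistant
-- from every vertex off those legs, so a resolving set meets all legs but one; conversely the
-- leaves of all legs but one resolve the spider, hence dim = m. The hub is the only vertex with
-- three neighbours, so automorphisms preserve depth and map leaves to leaves. Colouring leg i
-- with min(i, n − 1) gives the leaves distinct (depth, colour) pairs, so a colour-preserving
-- automorphism fixes the resolving set of leaves and is therefore the identity. With fewer than
-- n colours two pendant legs share a colour, and swapping them preserves the colouring: D = n.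
module Submission where

open import Defs
open import Algebra.Definitions.RawMonoid using (sum)
open import Data.Bool using (Bool; true; false)
open import Data.Empty using (⊥; ⊥-elim)
open import Data.Fin as Fin using (Fin; zero; suc; toℕ; fromℕ<; inject≤; punchIn)
open import Data.Fin.Permutation using (Permutation′; _⟨$⟩ʳ_; _⟨$⟩ˡ_; inverseˡ; inverseʳ; flip; transpose)
import Data.Fin.Permutation.Components as PC
open import Data.Fin.Properties
  using (toℕ<n; toℕ-fromℕ<; fromℕ<-toℕ; toℕ-injective; toℕ-inject≤; inject≤-injective;
         punchIn-injective; punchInᵢ≢i; any?; pigeonhole; injective⇒≤; +↔⊎; 1↔⊤)
import Data.Fin.Properties as Finₚ
open import Data.Fin.Subset using (Subset; _∈_; ∣_∣)
open import Data.Fin.Subset.Properties using (_∈?_)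
open import Data.Nat
  using (ℕ; zero; suc; _+_; _∸_; _⊓_; ∣_-_∣; _≤_; _<_; z≤n; s≤s; s≤s⁻¹; _≟_; _≤?_; +-0-rawMonoid)
open import Data.Nat.Properties
open import Data.Product using (Σ; ∃; _×_; _,_; proj₁; proj₂)
open import Data.Sum using (_⊎_; inj₁; inj₂; [_,_]′)
open import Data.Sum.Function.Propositional using (_⊎-↔_)
open import Data.Unit using (⊤; tt)
open import Data.Vec using (_∷_; here; there; tabulate; lookup)
open import Data.Vec.Properties using (lookup∘tabulate; []=⇒lookup; lookup⇒[]=)
open import Function using (_∘_; id; _↔_; Inverse; mk↔ₛ′; mk⇔)
open import Function.Properties.Inverse using (↔-refl; ↔-sym; ↔-trans)
open import Relation.Nullary using (¬_; Dec; yes; no; does; recompute)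
open import Relation.Nullary.Decidable
  using (dec-true; dec-false; does-⇔; decidable-stable; _×-dec_; _⊎-dec_; ¬?)
open import Relation.Binary.PropositionalEquality

dec-true⁻¹ : ∀ {A : Set} (a? : Dec A) → does a? ≡ true → A
dec-true⁻¹ (yes a) _ = a

transpose-first : ∀ {n} (i j : Fin n) → PC.transpose i j i ≡ j
transpose-first i j rewrite dec-true (i Fin.≟ i) refl = refl

transpose-second : ∀ {n} (i j : Fin n) → PC.transpose i j j ≡ i
transpose-second i j with j Fin.≟ i
... | yes refl = refl
... | no _ rewrite dec-true (j Fin.≟ j) refl = refl

transpose-other : ∀ {n} {i j k : Fin n} → k ≢ i → k ≢ j → PC.transpose i j k ≡ k
transpose-other {i = i} {j} {k} k≢i k≢j
  rewrite dec-false (k Fin.≟ i) k≢i | dec-false (k Fin.≟ j) k≢j = refl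

transpose-preserves : ∀ {n} {A : Set} (f : Fin n → A) {i j} → f i ≡ f j →
                      ∀ k → f (PC.transpose i j k) ≡ f k
transpose-preserves f {i} {j} fi≡fj k = by-cases (k Fin.≟ i) (k Fin.≟ j)
  where
  by-cases : Dec (k ≡ i) → Dec (k ≡ j) → f (PC.transpose i j k) ≡ f k
  by-cases (yes refl) _          = trans (cong f (transpose-first i j)) (sym fi≡fj)
  by-cases (no _)     (yes refl) = trans (cong f (transpose-second i j)) fi≡fj
  by-cases (no k≢i)   (no k≢j)   = cong f (transpose-other k≢i k≢j)

Σ-Fin↔Fin-sum : ∀ {M} (f : Fin M → ℕ) → Σ (Fin M) (Fin ∘ f) ↔ Fin (sum +-0-rawMonoid f)
Σ-Fin↔Fin-sum {zero}  f = mk↔ₛ′ (λ ()) (λ ()) (λ ()) (λ ())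
Σ-Fin↔Fin-sum {suc M} f =
  ↔-trans split (↔-trans (↔-refl ⊎-↔ Σ-Fin↔Fin-sum (f ∘ suc)) (↔-sym +↔⊎))
  where
  split : Σ (Fin (suc M)) (Fin ∘ f) ↔ (Fin (f zero) ⊎ Σ (Fin M) (Fin ∘ f ∘ suc))
  split = mk↔ₛ′ to from to-from from-to
    where
    to : Σ (Fin (suc M)) (Fin ∘ f) → Fin (f zero) ⊎ Σ (Fin M) (Fin ∘ f ∘ suc)
    to (zero  , k) = inj₁ k
    to (suc i , k) = inj₂ (i , k)
    from : Fin (f zero) ⊎ Σ (Fin M) (Fin ∘ f ∘ suc) → Σ (Fin (suc M)) (Fin ∘ f)
    from (inj₁ k)       = zero , k
    from (inj₂ (i , k)) = suc i , k
    to-from : ∀ y → to (from y) ≡ y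
    to-from (inj₁ _) = refl
    to-from (inj₂ _) = refl
    from-to : ∀ x → from (to x) ≡ x
    from-to (zero  , _) = refl
    from-to (suc _ , _) = refl

data Path {V : Set} (R : V → V → Set) : V → V → ℕ → Set where
  []  : ∀ {v} → Path R v v 0
  _∷_ : ∀ {u w v l} → R u w → Path R w v l → Path R u v (suc l)

module _ {V : Set} {R : V → V → Set} where

  _++_ : ∀ {u v w l l′} → Path R u v l → Path R v w l′ → Path R u w (l + l′)
  []      ++ q = q
  (a ∷ p) ++ q = a ∷ (p ++ q)

  reverse : (∀ {u v} → R u v → R v u) → ∀ {u v l} → Path R u v l → Path R v u l
  reverse R-sym []                 = []
  reverse R-sym (_∷_ {l = l} a p) =
    subst (Path R _ _) (+-comm l 1) (reverse R-sym p ++ (R-sym a ∷ []))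

IsDist-unique : ∀ {G x y d d′} → IsDist G x y d → IsDist G x y d′ → d ≡ d′
IsDist-unique (w , w-min) (w′ , w′-min) = ≤-antisym (w-min _ w′) (w′-min _ w)

module _ {G : Graph} where

  flip-automorphism : ∀ {π} → IsAutomorphism G π → IsAutomorphism G (flip π)
  flip-automorphism {π} aut x y =
    trans (sym (aut (π ⟨$⟩ˡ x) (π ⟨$⟩ˡ y))) (cong₂ (adj G) (inverseʳ π) (inverseʳ π))

  Walk-image : ∀ {π x y l} → IsAutomorphism G π →
               Walk G x y l → Walk G (π ⟨$⟩ʳ x) (π ⟨$⟩ʳ y) l
  Walk-image     aut here       = here
  Walk-image {π} aut (step a w) = step (trans (aut _ _) a) (Walk-image {π} aut w)

  Walk-preimage : ∀ {π x y l} → IsAutomorphism G π →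
                  Walk G (π ⟨$⟩ʳ x) (π ⟨$⟩ʳ y) l → Walk G x y l
  Walk-preimage {π} aut w =
    subst₂ (λ x y → Walk G x y _) (inverseˡ π) (inverseˡ π)
      (Walk-image {flip π} (flip-automorphism {π} aut) w)

  IsDist-image : ∀ {π x y d} → IsAutomorphism G π →
                 IsDist G x y d → IsDist G (π ⟨$⟩ʳ x) (π ⟨$⟩ʳ y) d
  IsDist-image {π} {x} {y} aut (w , w-min) =
    Walk-image {π} aut w , λ l w′ → w-min l (Walk-preimage {π} {x} {y} aut w′)

  -- An automorphism preserves the distances to the points it fixes, which tell all vertices apart.
  fixing-resolving-set⇒identity : ∀ {π S} → IsAutomorphism G π → Resolving G S →
                                  (∀ {s} → s ∈ S → π ⟨$⟩ʳ s ≡ s) → ∀ v → π ⟨$⟩ʳ v ≡ v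
  fixing-resolving-set⇒identity {π} aut resolving fixes v with π ⟨$⟩ʳ v Fin.≟ v
  ... | yes πv≡v = πv≡v
  ... | no πv≢v  with resolving (π ⟨$⟩ʳ v) v πv≢v
  ...   | s , s∈S , _ , _ , πv-s , v-s , d₁≢d₂ = ⊥-elim (d₁≢d₂ (IsDist-unique πv-s πv-πs))
    where
    πv-πs : IsDist G (π ⟨$⟩ʳ v) s _
    πv-πs = subst (λ t → IsDist G (π ⟨$⟩ʳ v) t _) (fixes s∈S) (IsDist-image {π} aut v-s)

rank : ∀ {n} (p : Subset n) {x} → x ∈ p → Fin ∣ p ∣
rank (true  ∷ p) {zero}  _           = zero
rank (true  ∷ p) {suc x} (there x∈p) = suc (rank p x∈p)
rank (false ∷ p) {suc x} (there x∈p) = rank p x∈p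

rank-injective : ∀ {n} (p : Subset n) {x y} (x∈p : x ∈ p) (y∈p : y ∈ p) →
                 rank p x∈p ≡ rank p y∈p → x ≡ y
rank-injective (true  ∷ p) {zero}  {zero}  _           _           _  = refl
rank-injective (true  ∷ p) {zero}  {suc y} _           (there _)   ()
rank-injective (true  ∷ p) {suc x} {zero}  (there _)   _           ()
rank-injective (true  ∷ p) {suc x} {suc y} (there x∈p) (there y∈p) eq =
  cong suc (rank-injective p x∈p y∈p (Finₚ.suc-injective eq))
rank-injective (false ∷ p) {suc x} {suc y} (there x∈p) (there y∈p) eq =
  cong suc (rank-injective p x∈p y∈p eq)

unrank : ∀ {n} (p : Subset n) → Fin ∣ p ∣ → Fin n
unrank (true  ∷ p) zero    = zero
unrank (true  ∷ p) (suc k) = suc (unrank p k)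
unrank (false ∷ p) k       = suc (unrank p k)

unrank-∈ : ∀ {n} (p : Subset n) k → unrank p k ∈ p
unrank-∈ (true  ∷ p) zero    = here
unrank-∈ (true  ∷ p) (suc k) = there (unrank-∈ p k)
unrank-∈ (false ∷ p) k       = there (unrank-∈ p k)

unrank-injective : ∀ {n} (p : Subset n) {k k′} → unrank p k ≡ unrank p k′ → k ≡ k′
unrank-injective (true  ∷ p) {zero}  {zero}   _  = refl
unrank-injective (true  ∷ p) {suc k} {suc k′} eq = cong suc (unrank-injective p (Finₚ.suc-injective eq))
unrank-injective (false ∷ p)                  eq = unrank-injective p (Finₚ.suc-injective eq)

injective⇒≤∣p∣ : ∀ {n m} (p : Subset n) (h : Fin m → Fin n) → (∀ k → h k ∈ p) →
                 (∀ {k k′} → h k ≡ h k′ → k ≡ k′) → m ≤ ∣ p ∣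
injective⇒≤∣p∣ p h h∈p h-inj = injective⇒≤ (h-inj ∘ rank-injective p (h∈p _) (h∈p _))

injectiveOn⇒∣p∣≤ : ∀ {n m} (p : Subset n) (h : ∀ {x} → x ∈ p → Fin m) →
                   (∀ {x y} (x∈p : x ∈ p) (y∈p : y ∈ p) → h x∈p ≡ h y∈p → x ≡ y) → ∣ p ∣ ≤ m
injectiveOn⇒∣p∣≤ p h h-inj =
  injective⇒≤ (unrank-injective p ∘ h-inj (unrank-∈ p _) (unrank-∈ p _))

module Presentation
  {V : Set} {N : ℕ} (enumeration : Fin N ↔ V)
  (Adj : V → V → Set) (Adj? : ∀ u v → Dec (Adj u v))
  (Adj-sym : ∀ {u v} → Adj u v → Adj v u) (Adj-irrefl : ∀ {v} → ¬ Adj v v)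
  (dist : V → V → ℕ) (geodesic : ∀ u v → Path Adj u v (dist u v))
  (dist-minimal : ∀ {u v l} → Path Adj u v l → dist u v ≤ l)
  where

  vertex : Fin N → V
  vertex = Inverse.to enumeration

  index : V → Fin N
  index = Inverse.from enumeration

  vertex-index : ∀ v → vertex (index v) ≡ v
  vertex-index = Inverse.strictlyInverseˡ enumeration

  index-vertex : ∀ x → index (vertex x) ≡ x
  index-vertex = Inverse.strictlyInverseʳ enumeration

  vertex-injective : ∀ {x y} → vertex x ≡ vertex y → x ≡ y
  vertex-injective {x} {y} eq = trans (sym (index-vertex x)) (trans (cong index eq) (index-vertex y))

  index-injective : ∀ {u v} → index u ≡ index v → u ≡ v
  index-injective {u} {v} eq = trans (sym (vertex-index u)) (trans (cong vertex eq) (vertex-index v))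

  graph : Graph
  graph = record
    { order      = N
    ; adj        = λ x y → does (Adj? (vertex x) (vertex y))
    ; adj-sym    = λ x y → does-⇔ (mk⇔ Adj-sym Adj-sym) (Adj? (vertex x) (vertex y)) (Adj? _ _)
    ; adj-irrefl = λ x → dec-false (Adj? _ _) Adj-irrefl
    }

  adj⇒Adj : ∀ {x y} → adj graph x y ≡ true → Adj (vertex x) (vertex y)
  adj⇒Adj = dec-true⁻¹ (Adj? _ _)

  Adj⇒adj : ∀ {u v} → Adj u v → adj graph (index u) (index v) ≡ true
  Adj⇒adj {u} {v} a = dec-true (Adj? _ _) (subst₂ Adj (sym (vertex-index u)) (sym (vertex-index v)) a)

  Walk⇒Path : ∀ {x y l} → Walk graph x y l → Path Adj (vertex x) (vertex y) l
  Walk⇒Path here       = []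
  Walk⇒Path (step a w) = adj⇒Adj a ∷ Walk⇒Path w

  Path⇒Walk : ∀ {u v l} → Path Adj u v l → Walk graph (index u) (index v) l
  Path⇒Walk []      = here
  Path⇒Walk (a ∷ p) = step (Adj⇒adj a) (Path⇒Walk p)

  isDist : ∀ x y → IsDist graph x y (dist (vertex x) (vertex y))
  isDist x y =
    subst₂ (λ x′ y′ → Walk graph x′ y′ (dist (vertex x) (vertex y))) (index-vertex x) (index-vertex y)
      (Path⇒Walk (geodesic _ _)) ,
    λ l w → dist-minimal (Walk⇒Path w)

  IsDist⇒≡dist : ∀ {x y d} → IsDist graph x y d → d ≡ dist (vertex x) (vertex y)
  IsDist⇒≡dist D = IsDist-unique D (isDist _ _)

  isDist-index : ∀ u v → IsDist graph (index u) (index v) (dist u v)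
  isDist-index u v =
    subst₂ (λ u′ v′ → IsDist graph _ _ (dist u′ v′)) (vertex-index u) (vertex-index v) (isDist _ _)

  connected : Connected graph
  connected x y = _ , proj₁ (isDist x y)

  Pendant : V → Set
  Pendant v = ∀ {a b} → Adj v a → Adj v b → a ≡ b

  module Symmetry {π : Permutation′ N} (aut : IsAutomorphism graph π) where

    image : V → V
    image v = vertex (π ⟨$⟩ʳ index v)

    preimage : V → V
    preimage v = vertex (π ⟨$⟩ˡ index v)

    image-preimage : ∀ v → image (preimage v) ≡ v
    image-preimage v = begin
      vertex (π ⟨$⟩ʳ index (vertex (π ⟨$⟩ˡ index v))) ≡⟨ cong (vertex ∘ (π ⟨$⟩ʳ_)) (index-vertex _) ⟩
      vertex (π ⟨$⟩ʳ (π ⟨$⟩ˡ index v))                ≡⟨ cong vertex (inverseʳ π) ⟩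
      vertex (index v)                                ≡⟨ vertex-index v ⟩
      v                                               ∎
      where open ≡-Reasoning

    image-injective : ∀ {u v} → image u ≡ image v → u ≡ v
    image-injective {u} {v} eq = begin
      u                                ≡⟨ sym (vertex-index u) ⟩
      vertex (index u)                 ≡⟨ cong vertex (sym (inverseˡ π)) ⟩
      vertex (π ⟨$⟩ˡ (π ⟨$⟩ʳ index u)) ≡⟨ cong (vertex ∘ (π ⟨$⟩ˡ_)) (vertex-injective eq) ⟩
      vertex (π ⟨$⟩ˡ (π ⟨$⟩ʳ index v)) ≡⟨ cong vertex (inverseˡ π) ⟩
      vertex (index v)                 ≡⟨ vertex-index v ⟩
      v                                ∎
      where open ≡-Reasoning

    image-fixed⇒fixed : ∀ {x} → image (vertex x) ≡ vertex x → π ⟨$⟩ʳ x ≡ x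
    image-fixed⇒fixed {x} eq = vertex-injective (trans (cong (vertex ∘ (π ⟨$⟩ʳ_)) (sym (index-vertex x))) eq)

    Adj-image : ∀ {u v} → Adj u v → Adj (image u) (image v)
    Adj-image a = adj⇒Adj (trans (aut _ _) (Adj⇒adj a))

    Adj-preimage : ∀ {u v} → Adj (image u) (image v) → Adj u v
    Adj-preimage {u} {v} a =
      subst₂ Adj (vertex-index u) (vertex-index v) (adj⇒Adj (trans (sym (aut _ _)) (dec-true (Adj? _ _) a)))

    dist-image : ∀ u v → dist (image u) (image v) ≡ dist u v
    dist-image u v = IsDist-unique (isDist _ _) (IsDist-image {π = π} aut (isDist-index u v))

    image-pendant : ∀ {v} → Pendant v → Pendant (image v)
    image-pendant {v} pendant {a} {b} va vb = begin
      a                    ≡⟨ sym (image-preimage a) ⟩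
      image (preimage a)   ≡⟨ cong image (pendant (Adj-preimage va′) (Adj-preimage vb′)) ⟩
      image (preimage b)   ≡⟨ image-preimage b ⟩
      b                    ∎
      where
      open ≡-Reasoning
      va′ = subst (Adj (image v)) (sym (image-preimage a)) va
      vb′ = subst (Adj (image v)) (sym (image-preimage b)) vb

  lift : V ↔ V → Permutation′ N
  lift φ = ↔-trans enumeration (↔-trans φ (↔-sym enumeration))

  lift-index : ∀ φ v → lift φ ⟨$⟩ʳ index v ≡ index (Inverse.to φ v)
  lift-index φ v = cong (index ∘ Inverse.to φ) (vertex-index v)

  lift-automorphism : ∀ (φ : V ↔ V) →
                      (∀ {u v} → Adj u v → Adj (Inverse.to φ u) (Inverse.to φ v)) →
                      (∀ {u v} → Adj u v → Adj (Inverse.from φ u) (Inverse.from φ v)) →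
                      IsAutomorphism graph (lift φ)
  lift-automorphism φ φ-Adj φ⁻¹-Adj x y = does-⇔ (mk⇔ backward forward) (Adj? _ _) (Adj? _ _)
    where
    open Inverse φ using (to; strictlyInverseʳ)
    φ′ : Fin N → V
    φ′ = vertex ∘ index ∘ to ∘ vertex
    forward : Adj (vertex x) (vertex y) → Adj (φ′ x) (φ′ y)
    forward a = subst₂ Adj (sym (vertex-index _)) (sym (vertex-index _)) (φ-Adj a)
    backward : Adj (φ′ x) (φ′ y) → Adj (vertex x) (vertex y)
    backward a = subst₂ Adj (strictlyInverseʳ _) (strictlyInverseʳ _)
                   (φ⁻¹-Adj (subst₂ Adj (vertex-index _) (vertex-index _) a))

∣n-1+n∣≡1 : ∀ n → ∣ n - suc n ∣ ≡ 1
∣n-1+n∣≡1 zero    = refl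
∣n-1+n∣≡1 (suc n) = ∣n-1+n∣≡1 n

two-of-three : ∀ {A : Set} {x y z c d : A} → x ≡ c ⊎ x ≡ d → y ≡ c ⊎ y ≡ d → z ≡ c ⊎ z ≡ d →
               x ≡ y ⊎ x ≡ z ⊎ y ≡ z
two-of-three (inj₁ refl) (inj₁ refl) _           = inj₁ refl
two-of-three (inj₂ refl) (inj₂ refl) _           = inj₁ refl
two-of-three (inj₁ refl) (inj₂ refl) (inj₁ refl) = inj₂ (inj₁ refl)
two-of-three (inj₁ refl) (inj₂ refl) (inj₂ refl) = inj₂ (inj₂ refl)
two-of-three (inj₂ refl) (inj₁ refl) (inj₁ refl) = inj₂ (inj₂ refl)
two-of-three (inj₂ refl) (inj₁ refl) (inj₂ refl) = inj₂ (inj₁ refl)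

module Spider {m : ℕ} (L : Fin (suc (suc m)) → ℕ) where

  Leg : Set
  Leg = Fin (suc (suc m))

  -- leg i k is the vertex at distance k + 1 from the hub on leg i, so leg i has L i + 1 vertices.
  data Vertex : Set where
    hub : Vertex
    leg : (i : Leg) (k : ℕ) → .(k ≤ L i) → Vertex

  leg-cong : ∀ {i j k k′} .{p : k ≤ L i} .{q : k′ ≤ L j} → i ≡ j → k ≡ k′ → leg i k p ≡ leg j k′ q
  leg-cong refl refl = refl

  leg-injectiveˡ : ∀ {i j k k′} .{p : k ≤ L i} .{q : k′ ≤ L j} → leg i k p ≡ leg j k′ q → i ≡ j
  leg-injectiveˡ refl = refl

  top : Leg → Vertex
  top i = leg i 0 z≤n

  leaf : Leg → Vertex
  leaf i = leg i (L i) ≤-refl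

  depth : Vertex → ℕ
  depth hub         = 0
  depth (leg _ k _) = suc k

  Adj : Vertex → Vertex → Set
  Adj hub         hub          = ⊥
  Adj hub         (leg _ k _)  = k ≡ 0
  Adj (leg _ k _) hub          = k ≡ 0
  Adj (leg i k _) (leg j k′ _) = i ≡ j × (suc k ≡ k′ ⊎ suc k′ ≡ k)

  Adj? : ∀ u v → Dec (Adj u v)
  Adj? hub         hub          = no λ ()
  Adj? hub         (leg _ k _)  = k ≟ 0
  Adj? (leg _ k _) hub          = k ≟ 0
  Adj? (leg i k _) (leg j k′ _) = i Fin.≟ j ×-dec (suc k ≟ k′ ⊎-dec suc k′ ≟ k)

  Adj-sym : ∀ {u v} → Adj u v → Adj v u
  Adj-sym {hub}       {leg _ _ _} a               = a
  Adj-sym {leg _ _ _} {hub}       a               = a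
  Adj-sym {leg _ _ _} {leg _ _ _} (refl , inj₁ e) = refl , inj₂ e
  Adj-sym {leg _ _ _} {leg _ _ _} (refl , inj₂ e) = refl , inj₁ e

  Adj-irrefl : ∀ {v} → ¬ Adj v v
  Adj-irrefl {leg _ k _} (_ , inj₁ e) = 1+n≢n e
  Adj-irrefl {leg _ k _} (_ , inj₂ e) = 1+n≢n e

  dist : Vertex → Vertex → ℕ
  dist hub         hub          = 0
  dist hub         (leg _ k _)  = suc k
  dist (leg _ k _) hub          = suc k
  dist (leg i k _) (leg j k′ _) with i Fin.≟ j
  ... | yes _ = ∣ k - k′ ∣
  ... | no _  = suc k + suc k′

  dist-sameLeg : ∀ i k k′ .(p : k ≤ L i) .(q : k′ ≤ L i) → dist (leg i k p) (leg i k′ q) ≡ ∣ k - k′ ∣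
  dist-sameLeg i k k′ _ _ with i Fin.≟ i
  ... | yes _  = refl
  ... | no i≢i = ⊥-elim (i≢i refl)

  dist-otherLeg : ∀ i j k k′ .(p : k ≤ L i) .(q : k′ ≤ L j) → i ≢ j →
                  dist (leg i k p) (leg j k′ q) ≡ suc k + suc k′
  dist-otherLeg i j k k′ _ _ i≢j with i Fin.≟ j
  ... | yes i≡j = ⊥-elim (i≢j i≡j)
  ... | no _    = refl

  toHub : ∀ i k .(p : k ≤ L i) → Path Adj (leg i k p) hub (suc k)
  toHub i zero    p = refl ∷ []
  toHub i (suc k) p = (refl , inj₂ refl) ∷ toHub i k (<⇒≤ p)

  descend : ∀ i k d .(p : d + k ≤ L i) → Path Adj (leg i (d + k) p) (leg i k (m+n≤o⇒n≤o d p)) d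
  descend i k zero    p = []
  descend i k (suc d) p = (refl , inj₂ refl) ∷ descend i k d (<⇒≤ p)

  descendTo : ∀ i {k k′} .{p : k ≤ L i} .{q : k′ ≤ L i} → k′ ≤ k → Path Adj (leg i k p) (leg i k′ q) (k ∸ k′)
  descendTo i {k} {k′} {p} {q} k′≤k =
    subst (λ v → Path Adj v (leg i k′ q) (k ∸ k′)) (leg-cong refl (m∸n+n≡m k′≤k))
      (descend i k′ (k ∸ k′) (subst (_≤ L i) (sym (m∸n+n≡m k′≤k)) p))

  alongLeg : ∀ i k k′ .(p : k ≤ L i) .(q : k′ ≤ L i) → Path Adj (leg i k p) (leg i k′ q) ∣ k - k′ ∣
  alongLeg i k k′ p q with ≤-total k′ k
  ... | inj₁ k′≤k = subst (Path Adj _ _) (sym (m≤n⇒∣n-m∣≡n∸m k′≤k)) (descendTo i k′≤k)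
  ... | inj₂ k≤k′ = subst (Path Adj _ _) (sym (m≤n⇒∣m-n∣≡n∸m k≤k′)) (reverse Adj-sym (descendTo i k≤k′))

  geodesic : ∀ u v → Path Adj u v (dist u v)
  geodesic hub         hub          = []
  geodesic hub         (leg j k q)  = reverse Adj-sym (toHub j k q)
  geodesic (leg i k p) hub          = toHub i k p
  geodesic (leg i k p) (leg j k′ q) with i Fin.≟ j
  ... | yes refl = alongLeg i k k′ p q
  ... | no _     = toHub i k p ++ reverse Adj-sym (toHub j k′ q)

  dist-self : ∀ v → dist v v ≡ 0
  dist-self hub         = refl
  dist-self (leg i k p) = trans (dist-sameLeg i k k p p) (∣n-n∣≡0 k)

  private
    step-bound : ∀ {k k′} → suc k ≡ k′ ⊎ suc k′ ≡ k → k ≤ suc k′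
    step-bound (inj₁ refl) = ≤-trans (n≤1+n _) (n≤1+n _)
    step-bound (inj₂ refl) = ≤-refl

    step-triangle : ∀ {k k′} l → suc k ≡ k′ ⊎ suc k′ ≡ k → ∣ k - l ∣ ≤ suc ∣ k′ - l ∣
    step-triangle {k} {k′} l s = ≤-trans (∣-∣-triangle k k′ l) (≤-reflexive (cong (_+ ∣ k′ - l ∣) (unit s)))
      where
      unit : suc k ≡ k′ ⊎ suc k′ ≡ k → ∣ k - k′ ∣ ≡ 1
      unit (inj₁ refl) = ∣n-1+n∣≡1 k
      unit (inj₂ refl) = trans (∣-∣-comm (suc k′) k′) (∣n-1+n∣≡1 k′)

  dist-edge : ∀ {u w} → Adj u w → ∀ v → dist u v ≤ suc (dist w v)
  dist-edge {hub}       {leg _ _ _} refl hub         = z≤n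
  dist-edge {leg _ _ _} {hub}       refl hub         = ≤-refl
  dist-edge {leg _ _ _} {leg _ _ _} (refl , s) hub   = s≤s (step-bound s)
  dist-edge {hub}       {leg i _ _} refl (leg j k′ _) with i Fin.≟ j
  ... | yes _ = ≤-refl
  ... | no _  = s≤s (≤-trans (n≤1+n _) (n≤1+n _))
  dist-edge {leg i _ _} {hub}       refl (leg j k′ _) with i Fin.≟ j
  ... | yes _ = ≤-trans (n≤1+n _) (n≤1+n _)
  ... | no _  = ≤-refl
  dist-edge {leg i k _} {leg _ _ _} (refl , s) (leg j l _) with i Fin.≟ j
  ... | yes _ = step-triangle l s
  ... | no _  = s≤s (+-monoˡ-≤ (suc l) (step-bound s))

  dist-minimal : ∀ {u v l} → Path Adj u v l → dist u v ≤ l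
  dist-minimal {u}     []      = ≤-reflexive (dist-self u)
  dist-minimal {v = v} (a ∷ p) = ≤-trans (dist-edge a v) (s≤s (dist-minimal p))

  enumeration : Fin (suc (sum +-0-rawMonoid (suc ∘ L))) ↔ Vertex
  enumeration = ↔-trans +↔⊎ (↔-trans (1↔⊤ ⊎-↔ ↔-sym (Σ-Fin↔Fin-sum (suc ∘ L))) (↔-sym code))
    where
    code : Vertex ↔ (⊤ ⊎ Σ Leg (Fin ∘ suc ∘ L))
    code = mk↔ₛ′ to from to-from from-to
      where
      to : Vertex → ⊤ ⊎ Σ Leg (Fin ∘ suc ∘ L)
      to hub         = inj₁ tt
      to (leg i k p) = inj₂ (i , fromℕ< (s≤s p))
      from : ⊤ ⊎ Σ Leg (Fin ∘ suc ∘ L) → Vertex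
      from (inj₁ tt)      = hub
      from (inj₂ (i , k)) = leg i (toℕ k) (s≤s⁻¹ (toℕ<n k))
      to-from : ∀ c → to (from c) ≡ c
      to-from (inj₁ tt)      = refl
      to-from (inj₂ (i , k)) = cong (λ k → inj₂ (i , k)) (fromℕ<-toℕ k _)
      from-to : ∀ v → from (to v) ≡ v
      from-to hub         = refl
      from-to (leg i k p) = leg-cong refl (toℕ-fromℕ< _)

  open Presentation enumeration Adj Adj? Adj-sym Adj-irrefl dist geodesic dist-minimal public

  dist-toOwnLeaf : ∀ i k .(p : k ≤ L i) → dist (leg i k p) (leaf i) ≡ L i ∸ k
  dist-toOwnLeaf i k p = trans (dist-sameLeg i k (L i) p ≤-refl) (m≤n⇒∣m-n∣≡n∸m (recompute (k ≤? L i) p))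

  ownLeaf-closer : ∀ i j a b .(p : a ≤ L i) .(q : b ≤ L j) → j ≢ i →
                   dist (leg i a p) (leaf i) ≢ dist (leg j b q) (leaf i)
  ownLeaf-closer i j a b p q j≢i eq = <⇒≢ (begin-strict
    L i ∸ a                   ≤⟨ m∸n≤m (L i) a ⟩
    L i                       <⟨ m≤n+m (suc (L i)) (suc b) ⟩
    suc b + suc (L i)         ≡⟨ sym (dist-otherLeg j i b (L i) q ≤-refl j≢i) ⟩
    dist (leg j b q) (leaf i) ∎)
    (trans (sym (dist-toOwnLeaf i a p)) eq)
    where open ≤-Reasoning

  Resolved : Vertex → Vertex → Set
  Resolved u v = ∃ λ k → dist u (leaf (suc k)) ≢ dist v (leaf (suc k))

  Resolved-sym : ∀ {u v} → Resolved u v → Resolved v u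
  Resolved-sym (k , ne) = k , ne ∘ sym

  dist-legZero-leaf₁ : ∀ a .(p : a ≤ L zero) →
                       dist (leg zero a p) (leaf (suc zero)) ≡ suc a + suc (L (suc zero))
  dist-legZero-leaf₁ a p = dist-otherLeg zero (suc zero) a (L (suc zero)) p ≤-refl λ ()

  hub-resolved : ∀ i b .(q : b ≤ L i) → Resolved hub (leg i b q)
  hub-resolved zero    b q = zero , λ eq → m≢1+n+m (suc (L (suc zero))) (trans eq (dist-legZero-leaf₁ b q))
  hub-resolved (suc i) b q =
    i , λ eq → <⇒≢ (s≤s (m∸n≤m (L (suc i)) b)) (sym (trans eq (dist-toOwnLeaf (suc i) b q)))

  sameLeg-resolved : ∀ i a b .(p : a ≤ L i) .(q : b ≤ L i) → a ≢ b → Resolved (leg i a p) (leg i b q)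
  sameLeg-resolved zero a b p q a≢b =
    zero , λ eq → a≢b (suc-injective (+-cancelʳ-≡ (suc (L (suc zero))) (suc a) (suc b)
      (trans (sym (dist-legZero-leaf₁ a p)) (trans eq (dist-legZero-leaf₁ b q)))))
  sameLeg-resolved (suc i) a b p q a≢b =
    i , λ eq → a≢b (∸-cancelˡ-≡ (recompute (a ≤? L (suc i)) p) (recompute (b ≤? L (suc i)) q)
      (trans (sym (dist-toOwnLeaf (suc i) a p)) (trans eq (dist-toOwnLeaf (suc i) b q))))

  otherLegs-resolved : ∀ i j a b .(p : a ≤ L i) .(q : b ≤ L j) → i ≢ j → Resolved (leg i a p) (leg j b q)
  otherLegs-resolved (suc i) j       a b p q i≢j = i , ownLeaf-closer (suc i) j a b p q (i≢j ∘ sym)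
  otherLegs-resolved zero    (suc j) a b p q i≢j =
    Resolved-sym {leg (suc j) b q} {leg zero a p} (j , ownLeaf-closer (suc j) zero b a q p i≢j)
  otherLegs-resolved zero    zero    a b p q i≢j = ⊥-elim (i≢j refl)

  resolve : ∀ u v → u ≢ v → Resolved u v
  resolve hub         hub         u≢v = ⊥-elim (u≢v refl)
  resolve hub         (leg j b q) _   = hub-resolved j b q
  resolve (leg i a p) hub         _   = Resolved-sym {hub} {leg i a p} (hub-resolved i a p)
  resolve (leg i a p) (leg j b q) u≢v with i Fin.≟ j
  ... | yes refl = sameLeg-resolved i a b p q (u≢v ∘ leg-cong refl)
  ... | no i≢j   = otherLegs-resolved i j a b p q i≢j

  isMarkedLeaf : Vertex → Bool
  isMarkedLeaf hub               = false
  isMarkedLeaf (leg zero _ _)    = false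
  isMarkedLeaf (leg (suc i) k _) = does (k ≟ L (suc i))

  markedLeaves : Subset (order graph)
  markedLeaves = tabulate (isMarkedLeaf ∘ vertex)

  ∈markedLeaves⇒ : ∀ {x} → x ∈ markedLeaves → ∃ λ k → vertex x ≡ leaf (suc k)
  ∈markedLeaves⇒ {x} x∈ =
    marked (vertex x) (trans (sym (lookup∘tabulate (isMarkedLeaf ∘ vertex) x)) ([]=⇒lookup x∈))
    where
    marked : ∀ v → isMarkedLeaf v ≡ true → ∃ λ k → v ≡ leaf (suc k)
    marked (leg (suc i) k p) eq = i , leg-cong refl (dec-true⁻¹ (k ≟ _) eq)

  leaf∈markedLeaves : ∀ k → index (leaf (suc k)) ∈ markedLeaves
  leaf∈markedLeaves k = lookup⇒[]= x markedLeaves (begin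
    lookup markedLeaves x        ≡⟨ lookup∘tabulate (isMarkedLeaf ∘ vertex) x ⟩
    isMarkedLeaf (vertex x)      ≡⟨ cong isMarkedLeaf (vertex-index (leaf (suc k))) ⟩
    isMarkedLeaf (leaf (suc k))  ≡⟨ dec-true (L (suc k) ≟ L (suc k)) refl ⟩
    true                         ∎)
    where
    open ≡-Reasoning
    x = index (leaf (suc k))

  markedLeaves-resolving : Resolving graph markedLeaves
  markedLeaves-resolving x y x≢y with resolve (vertex x) (vertex y) (x≢y ∘ vertex-injective)
  ... | k , d≢d = index (leaf (suc k)) , leaf∈markedLeaves k , _ , _ , isDist x _ , isDist y _ ,
                  subst (λ v → dist (vertex x) v ≢ dist (vertex y) v) (sym (vertex-index _)) d≢d

  ∣markedLeaves∣≤ : ∣ markedLeaves ∣ ≤ suc m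
  ∣markedLeaves∣≤ = injectiveOn⇒∣p∣≤ markedLeaves (λ x∈ → proj₁ (∈markedLeaves⇒ x∈)) λ x∈ y∈ eq →
    vertex-injective (trans (proj₂ (∈markedLeaves⇒ x∈))
                            (trans (cong (leaf ∘ suc) eq) (sym (proj₂ (∈markedLeaves⇒ y∈)))))

  OnLeg : Leg → Vertex → Set
  OnLeg i hub         = ⊥
  OnLeg i (leg j _ _) = j ≡ i

  OnLeg? : ∀ i v → Dec (OnLeg i v)
  OnLeg? i hub         = no λ ()
  OnLeg? i (leg j _ _) = j Fin.≟ i

  OnLeg-unique : ∀ {i j} v → OnLeg i v → OnLeg j v → i ≡ j
  OnLeg-unique (leg _ _ _) refl refl = refl

  top-equidistant : ∀ i j v → ¬ OnLeg i v → ¬ OnLeg j v → dist (top i) v ≡ dist (top j) v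
  top-equidistant i j hub         _     _     = refl
  top-equidistant i j (leg l c r) ¬on-i ¬on-j =
    trans (dist-otherLeg i l 0 c z≤n r (¬on-i ∘ sym)) (sym (dist-otherLeg j l 0 c z≤n r (¬on-j ∘ sym)))

  Hits : Subset (order graph) → Leg → Set
  Hits S i = ∃ λ x → x ∈ S × OnLeg i (vertex x)

  Hits? : ∀ S i → Dec (Hits S i)
  Hits? S i = any? λ x → x ∈? S ×-dec OnLeg? i (vertex x)

  resolving⇒hits-one-of-two : ∀ {S} → Resolving graph S → ∀ {i j} → i ≢ j → Hits S i ⊎ Hits S j
  resolving⇒hits-one-of-two {S} resolving {i} {j} i≢j
    with resolving (index (top i)) (index (top j)) (i≢j ∘ leg-injectiveˡ ∘ index-injective {top i} {top j})
  ... | s , s∈S , d₁ , d₂ , top-i-s , top-j-s , d₁≢d₂ with OnLeg? i (vertex s) | OnLeg? j (vertex s)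
  ... | yes on-i | _        = inj₁ (s , s∈S , on-i)
  ... | no _     | yes on-j = inj₂ (s , s∈S , on-j)
  ... | no ¬on-i | no ¬on-j = ⊥-elim (d₁≢d₂ (begin
    d₁                                       ≡⟨ IsDist⇒≡dist top-i-s ⟩
    dist (vertex (index (top i))) (vertex s) ≡⟨ cong (λ v → dist v (vertex s)) (vertex-index (top i)) ⟩
    dist (top i) (vertex s)                  ≡⟨ top-equidistant i j (vertex s) ¬on-i ¬on-j ⟩
    dist (top j) (vertex s)                  ≡⟨ cong (λ v → dist v (vertex s)) (vertex-index (top j)) ⟨
    dist (vertex (index (top j))) (vertex s) ≡⟨ IsDist⇒≡dist top-j-s ⟨
    d₂                                       ∎))
    where open ≡-Reasoning

  resolving⇒hits-all-but-one : ∀ {S} → Resolving graph S → ∃ λ a → ∀ j → j ≢ a → Hits S j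
  resolving⇒hits-all-but-one {S} resolving with any? (λ a → ¬? (Hits? S a))
  ... | yes (a , ¬hits-a) =
    a , λ j j≢a → [ ⊥-elim ∘ ¬hits-a , id ]′ (resolving⇒hits-one-of-two resolving (j≢a ∘ sym))
  ... | no ¬∃ = zero , λ j _ → decidable-stable (Hits? S j) (¬∃ ∘ (j ,_))

  resolving⇒size : ∀ {S} → Resolving graph S → suc m ≤ ∣ S ∣
  resolving⇒size {S} resolving with resolving⇒hits-all-but-one resolving
  ... | a , hits = injective⇒≤∣p∣ S witness (proj₁ ∘ proj₂ ∘ hits′) witness-injective
    where
    hits′ : ∀ k → Hits S (punchIn a k)
    hits′ k = hits (punchIn a k) (punchInᵢ≢i a k)
    witness : Fin (suc m) → Fin (order graph)
    witness = proj₁ ∘ hits′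
    witness-injective : ∀ {k k′} → witness k ≡ witness k′ → k ≡ k′
    witness-injective {k} {k′} eq = punchIn-injective a k k′ (OnLeg-unique (vertex (witness k))
      (proj₂ (proj₂ (hits′ k))) (subst (OnLeg _ ∘ vertex) (sym eq) (proj₂ (proj₂ (hits′ k′)))))

  metricDim : MetricDim graph (suc m)
  metricDim = (markedLeaves , markedLeaves-resolving ,
               ≤-antisym ∣markedLeaves∣≤ (resolving⇒size markedLeaves-resolving)) ,
              λ _ → resolving⇒size

  dist-toHub : ∀ v → dist v hub ≡ depth v
  dist-toHub hub         = refl
  dist-toHub (leg _ _ _) = refl

  neighbour-depth : ∀ {i k} .{p : k ≤ L i} {w} → Adj (leg i k p) w → depth w ≡ k ⊎ depth w ≡ suc (suc k)
  neighbour-depth {w = hub}       refl            = inj₁ refl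
  neighbour-depth {w = leg _ _ _} (_ , inj₁ refl) = inj₂ refl
  neighbour-depth {w = leg _ _ _} (_ , inj₂ refl) = inj₁ refl

  neighbours-by-depth : ∀ {i k} .{p : k ≤ L i} {a b} → Adj (leg i k p) a → Adj (leg i k p) b →
                        depth a ≡ depth b → a ≡ b
  neighbours-by-depth {a = hub}       {hub}       _          _          _  = refl
  neighbours-by-depth {a = leg _ _ _} {leg _ _ _} (refl , _) (refl , _) eq = leg-cong refl (suc-injective eq)

  three-neighbours⇒hub : ∀ {v a₁ a₂ a₃} → Adj v a₁ → Adj v a₂ → Adj v a₃ →
                         a₁ ≢ a₂ → a₁ ≢ a₃ → a₂ ≢ a₃ → v ≡ hub
  three-neighbours⇒hub {hub} _ _ _ _ _ _ = refl
  three-neighbours⇒hub {leg _ _ _} v-a₁ v-a₂ v-a₃ a₁≢a₂ a₁≢a₃ a₂≢a₃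
    with two-of-three (neighbour-depth v-a₁) (neighbour-depth v-a₂) (neighbour-depth v-a₃)
  ... | inj₁ d₁≡d₂        = ⊥-elim (a₁≢a₂ (neighbours-by-depth v-a₁ v-a₂ d₁≡d₂))
  ... | inj₂ (inj₁ d₁≡d₃) = ⊥-elim (a₁≢a₃ (neighbours-by-depth v-a₁ v-a₃ d₁≡d₃))
  ... | inj₂ (inj₂ d₂≡d₃) = ⊥-elim (a₂≢a₃ (neighbours-by-depth v-a₂ v-a₃ d₂≡d₃))

  leaf-pendant : ∀ i → Pendant (leaf i)
  leaf-pendant i leaf-a leaf-b =
    neighbours-by-depth leaf-a leaf-b (trans (neighbour-depth′ leaf-a) (sym (neighbour-depth′ leaf-b)))
    where
    neighbour-depth′ : ∀ {w} → Adj (leaf i) w → depth w ≡ L i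
    neighbour-depth′ {hub}       L≡0                = sym L≡0
    neighbour-depth′ {leg _ _ _} (refl , inj₂ e)    = e
    neighbour-depth′ {leg _ _ q} (refl , inj₁ refl) = ⊥-elim (1+n≰n (recompute (_ ≤? _) q))

  neighbourTowardsHub : ∀ i k .(p : k ≤ L i) → ∃ λ w → Adj (leg i k p) w × depth w ≡ k
  neighbourTowardsHub i zero    p = hub , refl , refl
  neighbourTowardsHub i (suc k) p = leg i k (<⇒≤ p) , (refl , inj₂ refl) , refl

  pendant⇒leaf : ∀ {i k} .{p : k ≤ L i} → Pendant (leg i k p) → k ≡ L i
  pendant⇒leaf {i} {k} {p} pendant with k <? L i
  ... | no k≮L  = ≤-antisym (recompute (k ≤? L i) p) (≮⇒≥ k≮L)
  ... | yes k<L with neighbourTowardsHub i k p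
  ...   | w , v-w , depth-w = ⊥-elim (<⇒≢ (n≤1+n (suc k))
    (sym (trans (cong depth (pendant {leg i (suc k) k<L} (refl , inj₁ refl) v-w)) depth-w)))

  module _ {π} (aut : IsAutomorphism graph π) where
    open Symmetry {π} aut

    image-hub : ∀ {i j k} → i ≢ j → i ≢ k → j ≢ k → image hub ≡ hub
    image-hub {i} {j} {k} i≢j i≢k j≢k =
      three-neighbours⇒hub (Adj-image {hub} {top i} refl) (Adj-image {hub} {top j} refl)
                           (Adj-image {hub} {top k} refl) (tops i≢j) (tops i≢k) (tops j≢k)
      where
      tops : ∀ {i j} → i ≢ j → image (top i) ≢ image (top j)
      tops {i} {j} i≢j = i≢j ∘ leg-injectiveˡ ∘ image-injective {top i} {top j}

    depth-image : image hub ≡ hub → ∀ v → depth (image v) ≡ depth v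
    depth-image image-hub≡hub v = begin
      depth (image v)            ≡⟨ dist-toHub (image v) ⟨
      dist (image v) hub         ≡⟨ cong (dist (image v)) image-hub≡hub ⟨
      dist (image v) (image hub) ≡⟨ dist-image v hub ⟩
      dist v hub                 ≡⟨ dist-toHub v ⟩
      depth v                    ∎
      where open ≡-Reasoning

  relabel : (f : Leg → Leg) → (∀ i → L (f i) ≡ L i) → Vertex → Vertex
  relabel f f-L hub         = hub
  relabel f f-L (leg i k p) = leg (f i) k (subst (k ≤_) (sym (f-L i)) p)

  relabel-Adj : ∀ f f-L {u v} → Adj u v → Adj (relabel f f-L u) (relabel f f-L v)
  relabel-Adj f f-L {hub}       {leg _ _ _} u-v        = u-v
  relabel-Adj f f-L {leg _ _ _} {hub}       u-v        = u-v
  relabel-Adj f f-L {leg _ _ _} {leg _ _ _} (refl , s) = refl , s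

  relabel-inverse : ∀ f f-L g g-L → (∀ i → f (g i) ≡ i) → ∀ v → relabel f f-L (relabel g g-L v) ≡ v
  relabel-inverse f f-L g g-L f∘g≗id hub         = refl
  relabel-inverse f f-L g g-L f∘g≗id (leg i k p) = leg-cong (f∘g≗id i) refl

  permuteLegs : (σ : Permutation′ (suc (suc m))) → (∀ i → L (σ ⟨$⟩ʳ i) ≡ L i) → Vertex ↔ Vertex
  permuteLegs σ σ-L = mk↔ₛ′ (relabel (σ ⟨$⟩ʳ_) σ-L) (relabel (σ ⟨$⟩ˡ_) σ⁻¹-L)
    (relabel-inverse _ σ-L _ σ⁻¹-L (λ _ → inverseʳ σ)) (relabel-inverse _ σ⁻¹-L _ σ-L (λ _ → inverseˡ σ))
    where
    σ⁻¹-L : ∀ i → L (σ ⟨$⟩ˡ i) ≡ L i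
    σ⁻¹-L i = trans (sym (σ-L (σ ⟨$⟩ˡ i))) (cong L (inverseʳ σ))

  permuteLegs-automorphism : ∀ σ σ-L → IsAutomorphism graph (lift (permuteLegs σ σ-L))
  permuteLegs-automorphism σ σ-L = lift-automorphism (permuteLegs σ σ-L) (relabel-Adj _ _) (relabel-Adj _ _)

  -- Transposing two pendant legs is an automorphism that moves top A but keeps the colour of every vertex.
  same-coloured-pendant-legs⇒¬distinguishing :
    ∀ {A B} → A ≢ B → L A ≡ 0 → L B ≡ 0 → ∀ {r} (c : Fin (order graph) → Fin r) →
    c (index (top A)) ≡ c (index (top B)) → ¬ Distinguishing graph c
  same-coloured-pendant-legs⇒¬distinguishing {A} {B} A≢B L-A L-B c same-colour distinguishing =
    A≢B (sym (leg-injectiveˡ (index-injective {top B} {top A} (begin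
      index (top B)                         ≡⟨ cong (index ∘ top) (transpose-first A B) ⟨
      index (relabel (τ ⟨$⟩ʳ_) τ-L (top A)) ≡⟨ lift-index swap (top A) ⟨
      lift swap ⟨$⟩ʳ index (top A)          ≡⟨ distinguishing (lift swap) (permuteLegs-automorphism τ τ-L)
                                                 colour-preserved (index (top A)) ⟩
      index (top A)                         ∎))))
    where
    open ≡-Reasoning
    τ : Permutation′ (suc (suc m))
    τ = transpose A B
    τ-L : ∀ i → L (τ ⟨$⟩ʳ i) ≡ L i
    τ-L = transpose-preserves L (trans L-A (sym L-B))
    swap : Vertex ↔ Vertex
    swap = permuteLegs τ τ-L
    relabel-colour : ∀ v → c (index (relabel (τ ⟨$⟩ʳ_) τ-L v)) ≡ c (index v)
    relabel-colour hub               = refl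
    relabel-colour (leg i zero _)    = transpose-preserves (c ∘ index ∘ top) same-colour i
    relabel-colour (leg i (suc k) p) = cong (c ∘ index)
      (leg-cong {p = subst (suc k ≤_) (sym (τ-L i)) p} {q = p} (transpose-other (long L-A) (long L-B)) refl)
      where
      long : ∀ {j} → L j ≡ 0 → i ≢ j
      long L-j refl with () ← subst (suc k ≤_) L-j (recompute (suc k ≤? L i) p)
    colour-preserved : ∀ x → c (lift swap ⟨$⟩ʳ x) ≡ c x
    colour-preserved x = trans (relabel-colour (vertex x)) (cong c (index-vertex x))

module Construction (n′ m₀ : ℕ) (n<m : suc n′ < suc (suc m₀)) where

  legLength : Fin (suc (suc (suc m₀))) → ℕ
  legLength i = toℕ i ∸ n′

  open Spider legLength public

  legColour : Leg → Fin (suc n′)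
  legColour i = fromℕ< (s≤s (m⊓n≤m n′ (toℕ i)))

  -- A leg i is determined by its colour n′ ⊓ i and its length i ∸ n′, which add up to i.
  legColour-legLength-injective : ∀ {i j} → legColour i ≡ legColour j → legLength i ≡ legLength j → i ≡ j
  legColour-legLength-injective {i} {j} colour-eq length-eq = toℕ-injective (begin
    toℕ i                    ≡⟨ m⊓n+n∸m≡n n′ (toℕ i) ⟨
    n′ ⊓ toℕ i + legLength i ≡⟨ cong₂ _+_ colours length-eq ⟩
    n′ ⊓ toℕ j + legLength j ≡⟨ m⊓n+n∸m≡n n′ (toℕ j) ⟩
    toℕ j                    ∎)
    where
    open ≡-Reasoning
    colours : n′ ⊓ toℕ i ≡ n′ ⊓ toℕ j
    colours = trans (sym (toℕ-fromℕ< _)) (trans (cong toℕ colour-eq) (toℕ-fromℕ< _))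

  vertexColour : Vertex → Fin (suc n′)
  vertexColour hub         = zero
  vertexColour (leg i _ _) = legColour i

  colouring : Fin (order graph) → Fin (suc n′)
  colouring = vertexColour ∘ vertex

  leaf-rigid : ∀ i w → depth w ≡ depth (leaf i) → Pendant w → vertexColour w ≡ legColour i → w ≡ leaf i
  leaf-rigid i (leg j k q) depth-eq pendant colour-eq
    with legColour-legLength-injective colour-eq (trans (sym (pendant⇒leaf pendant)) (suc-injective depth-eq))
  ... | refl = leg-cong refl (suc-injective depth-eq)

  colouring-distinguishing : Distinguishing graph colouring
  colouring-distinguishing π aut colour-preserved =
    fixing-resolving-set⇒identity {π = π} aut markedLeaves-resolving fixes-markedLeaves
    where
    open Symmetry {π} aut
    image-hub≡hub : image hub ≡ hub
    image-hub≡hub = image-hub {π} aut {zero} {suc zero} {suc (suc zero)} (λ ()) (λ ()) (λ ())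
    image-leaf : ∀ i → image (leaf i) ≡ leaf i
    image-leaf i = leaf-rigid i (image (leaf i))
      (depth-image {π} aut image-hub≡hub (leaf i))
      (image-pendant (leaf-pendant i))
      (trans (colour-preserved (index (leaf i))) (cong vertexColour (vertex-index (leaf i))))
    fixes-markedLeaves : ∀ {s} → s ∈ markedLeaves → π ⟨$⟩ʳ s ≡ s
    fixes-markedLeaves s∈ with ∈markedLeaves⇒ s∈
    ... | k , s-leaf = image-fixed⇒fixed (trans (cong image s-leaf) (trans (image-leaf (suc k)) (sym s-leaf)))

  pendantLeg : Fin (suc n′) → Leg
  pendantLeg a = inject≤ a (≤-trans (<⇒≤ n<m) (n≤1+n _))

  legLength-pendantLeg : ∀ a → legLength (pendantLeg a) ≡ 0
  legLength-pendantLeg a = m≤n⇒m∸n≡0 (subst (_≤ n′) (sym (toℕ-inject≤ a _)) (s≤s⁻¹ (toℕ<n a)))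

  distinguishing⇒≥ : ∀ r (c : Fin (order graph) → Fin r) → Distinguishing graph c → suc n′ ≤ r
  distinguishing⇒≥ r c distinguishing with suc n′ ≤? r
  ... | yes n≤r = n≤r
  ... | no n≰r with pigeonhole (≰⇒> n≰r) (c ∘ index ∘ top ∘ pendantLeg)
  ...   | a , b , a<b , same-colour = ⊥-elim (same-coloured-pendant-legs⇒¬distinguishing
    (Finₚ.<⇒≢ a<b ∘ inject≤-injective _ _ a b) (legLength-pendantLeg a) (legLength-pendantLeg b)
    c same-colour distinguishing)

proposition3p4 : ∀ (n m : ℕ) → 1 ≤ n → n < m →
    Σ Graph (λ G → Connected G × DistNumber G n × MetricDim G m)
proposition3p4 zero     _              ()  _
proposition3p4 (suc n′) zero           _   ()
proposition3p4 (suc n′) (suc zero)     _   (s≤s ())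
proposition3p4 (suc n′) (suc (suc m₀)) _   n<m =
  graph , connected , ((colouring , colouring-distinguishing) , distinguishing⇒≥) , metricDim
  where open Construction n′ m₀ n<m
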